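{- For every constant $\varepsilon\in(0,1)$ there is a constant $K_\varepsilon$ such that the following holds. Let $F=\bigwedge_{i\in[m]}C_i$ be a conjunction of $\oplus$-clauses over $n$ variables that has a Hitting$(\oplus)$ refutation of size $s$, let $X\sqcup Y=[n]$ be any partition of the variables, and let $S=\{(x,y,j)\in\{0,1\}^X\times\{0,1\}^Y\times[m]: C_j(x,y)=0\}$. Then $\mathrm{prt}_\varepsilon(S)\le K_\varepsilon s^2$.
   Context: A $\oplus$-clause is a disjunction of affine equations over $\mathrm{GF}(2)$ of the form $\bigoplus_{i\in I}x_i=c$ (a literal $x$ is $x=1$, $\bar x$ is $x=0$); it is falsified exactly on an affine subspace. A hitting$(\oplus)$ formula is a conjunction of $\oplus$-clauses no two of which have a common falsifying assignment. A Hitting$(\oplus)$ refutation of a set $F$ of $\oplus$-clauses is an unsatisfiable hitting$(\oplus)$ formula $H$ such that every $\oplus$-clause $C$ of $H$ has some $C'\subseteq C$ in $F$ (as sets of equations); its size is the number of $\oplus$-clauses of $H$. Partition bound (Jain–Klauck): for $S\subseteq\mathcal X\times\mathcal Y\times\mathcal O$, let $\mathsf{rect}$ be the set of rectangles $A\times B$ with $A\subseteq\mathcal X$, $B\subseteq\mathcal Y$, and $\mathrm{supp}(S)=\{(x,y):\exists o\,(x,y,o)\in S\}$. $\mathrm{prt}_\varepsilon(S)$ is the minimum of $\sum_{o\in\mathcal O}\sum_{R\in\mathsf{rect}}w_{o,R}$ over weights $w_{o,R}\ge0$ satisfying: for all $(x,y)\in\mathrm{supp}(S)$, $\sum_{o:(x,y,o)\in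 S}\sum_{R\ni(x,y)}w_{o,R}\ge1-\varepsilon$; and for all $(x,y)\in\mathcal X\times\mathcal Y$, $\sum_{o\in\mathcal O}\sum_{R\ni(x,y)}w_{o,R}=1$.
   Formalization: The parameter ε ranges over the rationals in (0,1), and the constant $K_\varepsilon$ and the weights $w_{o,R}$ are taken in ℚ. -}

module Defs where

open import Data.Bool using (Bool; true; false; _xor_; _∧_; not; if_then_else_)
open import Data.Nat as ℕ using (ℕ)
open import Data.Integer using (+_)
open import Data.Fin using (Fin)
open import Data.Fin.Subset using (Subset)
open import Data.Vec using (Vec; foldr′; zipWith; tabulate)
open import Data.List using (List; foldr)
open import Data.List.Membership.Propositional using (_∈_)
open import Data.List.Relation.Unary.All using (All)
open import Data.List.Relation.Unary.Any using (Any)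
open import Data.Sum using (_⊎_; [_,_])
open import Data.Product using (Σ; ∃; _×_; _,_)
open import Data.Rational using (ℚ; 0ℚ; _+_; _-_; _≤_; 1ℚ; _/_)
open import Function.Bundles using (_↔_; Inverse)
open import Relation.Binary.PropositionalEquality using (_≡_; _≢_)
open import Relation.Nullary using (¬_)

Assignment : ℕ → Set
Assignment n = Fin n → Bool

-- Affine equation ⊕_{i ∈ I} x_i = c : the support I (a subset of [n]) and c.
Equation : ℕ → Set
Equation n = Subset n × Bool

parity : ∀ {n} → Subset n → Assignment n → Bool
parity I α = foldr′ _xor_ false (zipWith _∧_ I (tabulate α))

satEqᵇ : ∀ {n} → Equation n → Assignment n → Bool
satEqᵇ (I , c) α = not (parity I α xor c)

-- A ⊕-clause: a (finite set, given as a list of) affine equations, read disjunctively.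
Clause : ℕ → Set
Clause n = List (Equation n)

falsifiesᵇ : ∀ {n} → Assignment n → Clause n → Bool
falsifiesᵇ α C = foldr (λ e acc → not (satEqᵇ e α) ∧ acc) true C

Falsifies : ∀ {n} → Assignment n → Clause n → Set
Falsifies α C = falsifiesᵇ α C ≡ true

_⊆ᶜ_ : ∀ {n} → Clause n → Clause n → Set
C′ ⊆ᶜ C = ∀ {e} → e ∈ C′ → e ∈ C

IsHitting : ∀ {n s} → (Fin s → Clause n) → Set
IsHitting {n} {s} H = ∀ (i j : Fin s) → i ≢ j → ∀ (α : Assignment n) →
  ¬ (Falsifies α (H i) × Falsifies α (H j))

Unsat : ∀ {n s} → (Fin s → Clause n) → Set
Unsat {n} {s} H = ∀ (α : Assignment n) → ∃ λ (j : Fin s) → Falsifies α (H j)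

IsHittingRefutation : ∀ {n m s} → (Fin m → Clause n) → (Fin s → Clause n) → Set
IsHittingRefutation {m = m} {s = s} F H =
  IsHitting H × Unsat H × (∀ (j : Fin s) → ∃ λ (i : Fin m) → F i ⊆ᶜ H j)

-- Partition bound data.  Given a partition [n] ≅ X ⊔ Y with |X| = a, |Y| = b,
-- inputs are x : {0,1}^X and y : {0,1}^Y, and the full assignment is:
join : ∀ {n a b} → (Fin n ↔ (Fin a ⊎ Fin b)) →
       Assignment a → Assignment b → Assignment n
join e x y i = [ x , y ] (Inverse.to e i)

record Rect (a b : ℕ) : Set where
  constructor rect
  field
    A : Assignment a → Bool
    B : Assignment b → Bool

inRectᵇ : ∀ {a b} → Assignment a → Assignment b → Rect a b → Bool
inRectᵇ x y (rect A B) = A x ∧ B y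

-- A finitely supported weight function w_{o,R} (o ∈ [m]) given as a list of
-- weighted entries (o , R , w); w_{o,R} is the sum of the weights of entries with that (o,R).
record Entry (m a b : ℕ) : Set where
  constructor entry
  field
    out    : Fin m
    rectangle : Rect a b
    weight : ℚ

Weights : ℕ → ℕ → ℕ → Set
Weights m a b = List (Entry m a b)

sumℚ : ∀ {A : Set} → (A → ℚ) → List A → ℚ
sumℚ f = foldr (λ z acc → f z + acc) 0ℚ

total : ∀ {m a b} → Weights m a b → ℚ
total = sumℚ Entry.weight

sumWhere : ∀ {m a b} → (Entry m a b → Bool) → Weights m a b → ℚ
sumWhere c = sumℚ (λ en → if c en then Entry.weight en else 0ℚ)

Nonneg : ∀ {m a b} → Weights m a b → Set
Nonneg L = All (λ en → 0ℚ ≤ Entry.weight en) L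

InSupp : ∀ {n m a b} → (Fin m → Clause n) → (Fin n ↔ (Fin a ⊎ Fin b)) →
         Assignment a → Assignment b → Set
InSupp {m = m} F e x y = ∃ λ (j : Fin m) → Falsifies (join e x y) (F j)

-- Feasibility of weights for the partition-bound LP of S with error ε:
-- nonnegativity; for (x,y) ∈ supp(S): Σ_{o : C_o(x,y)=0} Σ_{R ∋ (x,y)} w_{o,R} ≥ 1 - ε;
-- for all (x,y): Σ_o Σ_{R ∋ (x,y)} w_{o,R} = 1.
Feasible : ∀ {n m a b} → ℚ → (Fin m → Clause n) → (Fin n ↔ (Fin a ⊎ Fin b)) →
           Weights m a b → Set
Feasible {n} {m} {a} {b} ε F e L =
  Nonneg L ×
  (∀ (x : Assignment a) (y : Assignment b) → InSupp F e x y →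
     1ℚ - ε ≤ sumWhere (λ en → falsifiesᵇ (join e x y) (F (Entry.out en))
                               ∧ inRectᵇ x y (Entry.rectangle en)) L) ×
  (∀ (x : Assignment a) (y : Assignment b) →
     sumWhere (λ en → inRectᵇ x y (Entry.rectangle en)) L ≡ 1ℚ)

ℕtoℚ : ℕ → ℚ
ℕtoℚ k = + k / 1

{-# OPTIONS --safe #-}
module Submission where

-- For a ⊕-clause C with k equations, the XORs of the truth values of the 2^k sub-families of its
-- equations are affine functions of (x , y) of the form f x ⊕ g y, so the zero set of each is the
-- union of the two rectangles {f = 0} × {g = 0} and {f = 1} × {g = 1}. A point falsifying C lies
-- in all 2^k zero sets, any other point in exactly half of them. After padding the clauses of H to
-- a common length with the equation 0 = 1, t-fold intersections of these rectangles cover a point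
-- T B times if it falsifies the clause and B times otherwise, where T = 2^t. As H is a hitting
-- refutation, every point falsifies exactly one clause of H; so giving all rectangles the weight
-- 1 / (T B + (s - 1) B), each labelled by a clause of F contained in its clause of H, covers every
-- point with total weight 1, of which T / (T + s - 1) ≥ 1 - ε carries a falsified clause of F as
-- soon as T ≥ s q with 1 / q ≤ ε. Taking T ≤ 2 s q, the total weight s T² / (T + s - 1) is at
-- most 2 q s².

open import Algebra.Bundles using (CommutativeRing; CommutativeMonoid)
import Algebra.Properties.CommutativeSemigroup as CommutativeSemigroupProperties
import Algebra.Properties.CommutativeMonoid.Sum as CommutativeMonoidSum
open import Data.Bool using (Bool; true; false; not; _∧_; _xor_; if_then_else_)
open import Data.Bool.Properties
  using (xor-∧-commutativeRing; ∧-commutativeMonoid; ∧-distribˡ-xor; xor-assoc;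
         not-distribʳ-xor; not-involutive; xor-identityʳ; if-float)
open import Data.Bool.ListAction using (or)
open import Data.Empty using (⊥-elim)
open import Data.Fin using (Fin; zero; suc; punchIn)
open import Data.Fin.Subset using (Subset)
open import Data.Fin.Properties using (punchInᵢ≢i; ¬Fin0)
import Data.Integer as ℤ
import Data.Integer.Properties as ℤ
open import Data.List
  using (List; []; _∷_; _++_; map; length; replicate; concat; tabulate; cartesianProductWith)
open import Data.List.Properties using (length-map; length-++; length-replicate; map-++; map-∘; map-cong)
open import Data.List.Membership.Propositional using (_∈_)
open import Data.List.Relation.Unary.Any using (here; there)
open import Data.List.Relation.Unary.All as All using (All)
import Data.List.Relation.Unary.All.Properties as All
open import Data.Nat as ℕ using (ℕ; zero; suc; _∸_; _^_; NonZero)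
import Data.Nat.Properties as ℕ
open import Data.Nat.Coprimality using (1-coprimeTo) renaming (sym to coprime-sym)
open import Data.Nat.Tactic.RingSolver using (solve-∀)
open import Data.Product using (∃; _×_; _,_; proj₁; proj₂)
open import Data.Rational
  using (ℚ; mkℚ; 0ℚ; 1ℚ; _<_; _≤_; _+_; _-_; _*_; -_; _/_; 1/_; *≤*; ↧ₙ_; NonNegative; Positive; positive)
open import Data.Rational.Properties as ℚ using ()
open import Data.Sum using (_⊎_; inj₁; inj₂)
import Data.Vec as Vec
open import Data.Vec.Functional using (Vector; removeAt)
open import Function using (_∘_; id)
open import Function.Bundles using (_↔_; Inverse)
open import Relation.Binary.PropositionalEquality
open import Relation.Nullary using (yes; no)

open import Defs

ℕtoℚ≡mkℚ : ∀ k → ℕtoℚ k ≡ mkℚ (ℤ.+ k) 0 (coprime-sym (1-coprimeTo k))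
ℕtoℚ≡mkℚ k = ℚ.normalize-coprime (coprime-sym (1-coprimeTo k))

ℕtoℚ-+ : ∀ a b → ℕtoℚ (a ℕ.+ b) ≡ ℕtoℚ a + ℕtoℚ b
ℕtoℚ-+ a b rewrite ℕtoℚ≡mkℚ a | ℕtoℚ≡mkℚ b | ℤ.*-identityʳ (ℤ.+ a) | ℤ.*-identityʳ (ℤ.+ b) = refl

ℕtoℚ-* : ∀ a b → ℕtoℚ (a ℕ.* b) ≡ ℕtoℚ a * ℕtoℚ b
ℕtoℚ-* a b rewrite ℕtoℚ≡mkℚ a | ℕtoℚ≡mkℚ b = cong (_/ 1) (ℤ.pos-* a b)

ℕtoℚ-mono-≤ : ∀ {a b} → a ℕ.≤ b → ℕtoℚ a ≤ ℕtoℚ b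
ℕtoℚ-mono-≤ {a} {b} a≤b rewrite ℕtoℚ≡mkℚ a | ℕtoℚ≡mkℚ b =
  *≤* (subst₂ ℤ._≤_ (sym (ℤ.*-identityʳ (ℤ.+ a))) (sym (ℤ.*-identityʳ (ℤ.+ b))) (ℤ.+≤+ a≤b))

ℕtoℚ-pos : ∀ k .{{_ : NonZero k}} → Positive (ℕtoℚ k)
ℕtoℚ-pos k = ℚ.normalize-pos k 1

ℕtoℚ-suc-* : ∀ k w → ℕtoℚ (suc k) * w ≡ w + ℕtoℚ k * w
ℕtoℚ-suc-* k w = begin
  ℕtoℚ (suc k) * w              ≡⟨ cong (_* w) (ℕtoℚ-+ 1 k) ⟩
  (1ℚ + ℕtoℚ k) * w             ≡⟨ ℚ.*-distribʳ-+ w 1ℚ (ℕtoℚ k) ⟩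
  1ℚ * w + ℕtoℚ k * w           ≡⟨ cong (_+ ℕtoℚ k * w) (ℚ.*-identityˡ w) ⟩
  w + ℕtoℚ k * w                ∎
  where open ≡-Reasoning

-- Written on the normal form of b, so that it computes when b is a successor.
recip : (b : ℕ) .{{_ : NonZero b}} → ℚ
recip (suc b) = 1/ mkℚ (ℤ.+ suc b) 0 (coprime-sym (1-coprimeTo (suc b)))

recip-nonNeg : ∀ b .{{_ : NonZero b}} → NonNegative (recip b)
recip-nonNeg (suc b) = _

ℕtoℚ*recip≡1 : ∀ b .{{_ : NonZero b}} → ℕtoℚ b * recip b ≡ 1ℚ
ℕtoℚ*recip≡1 (suc b) rewrite ℕtoℚ≡mkℚ (suc b) =
  ℚ.*-inverseʳ (mkℚ (ℤ.+ suc b) 0 (coprime-sym (1-coprimeTo (suc b))))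

recip[↧ₙ]≤ : ∀ ε → 0ℚ < ε → recip (↧ₙ ε) ≤ ε
recip[↧ₙ]≤ ε 0<ε = go ε (positive 0<ε)
  where
  go : ∀ ε → Positive ε → recip (↧ₙ ε) ≤ ε
  go (mkℚ ℤ.+[1+ p ] d _) _ = *≤* (ℤ.+≤+ (ℕ.*-monoˡ-≤ (suc d) (ℕ.s≤s (ℕ.z≤n {p}))))

ℕtoℚ*recip-mono-≤ : ∀ a b c d .{{_ : NonZero b}} .{{_ : NonZero d}} →
  a ℕ.* d ℕ.≤ c ℕ.* b → ℕtoℚ a * recip b ≤ ℕtoℚ c * recip d
ℕtoℚ*recip-mono-≤ a b c d ad≤cb =
  ℚ.*-cancelʳ-≤-pos (ℕtoℚ b * ℕtoℚ d) {{bd-pos}} (begin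
    ℕtoℚ a * recip b * (ℕtoℚ b * ℕtoℚ d)  ≡⟨ cancel a b d ⟩
    ℕtoℚ a * ℕtoℚ d                        ≡⟨ ℕtoℚ-* a d ⟨
    ℕtoℚ (a ℕ.* d)                         ≤⟨ ℕtoℚ-mono-≤ ad≤cb ⟩
    ℕtoℚ (c ℕ.* b)                         ≡⟨ ℕtoℚ-* c b ⟩
    ℕtoℚ c * ℕtoℚ b                        ≡⟨ cancel c d b ⟨
    ℕtoℚ c * recip d * (ℕtoℚ d * ℕtoℚ b)  ≡⟨ cong (ℕtoℚ c * recip d *_) (ℚ.*-comm (ℕtoℚ d) _) ⟩
    ℕtoℚ c * recip d * (ℕtoℚ b * ℕtoℚ d)  ∎)
  where
  open ℚ.≤-Reasoning

  bd-pos : Positive (ℕtoℚ b * ℕtoℚ d)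
  bd-pos = subst Positive (ℕtoℚ-* b d) (ℕtoℚ-pos (b ℕ.* d) {{ℕ.m*n≢0 b d}})

  cancel : ∀ x y z .{{_ : NonZero y}} → ℕtoℚ x * recip y * (ℕtoℚ y * ℕtoℚ z) ≡ ℕtoℚ x * ℕtoℚ z
  cancel x y z = begin-equality
    ℕtoℚ x * recip y * (ℕtoℚ y * ℕtoℚ z)    ≡⟨ ℚ.*-assoc (ℕtoℚ x) (recip y) _ ⟩
    ℕtoℚ x * (recip y * (ℕtoℚ y * ℕtoℚ z))  ≡⟨ cong (ℕtoℚ x *_) (ℚ.*-assoc (recip y) _ _) ⟨
    ℕtoℚ x * (recip y * ℕtoℚ y * ℕtoℚ z)    ≡⟨ cong (λ u → ℕtoℚ x * (u * ℕtoℚ z)) y⁻¹y≡1 ⟩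
    ℕtoℚ x * (1ℚ * ℕtoℚ z)                  ≡⟨ cong (ℕtoℚ x *_) (ℚ.*-identityˡ (ℕtoℚ z)) ⟩
    ℕtoℚ x * ℕtoℚ z                         ∎
    where y⁻¹y≡1 = trans (ℚ.*-comm (recip y) (ℕtoℚ y)) (ℕtoℚ*recip≡1 y)

x+y≡1⇒1-ε≤x : ∀ {x y ε} → x + y ≡ 1ℚ → y ≤ ε → 1ℚ - ε ≤ x
x+y≡1⇒1-ε≤x {x} {y} {ε} x+y≡1 y≤ε = begin
  1ℚ - ε       ≤⟨ ℚ.+-monoʳ-≤ 1ℚ (ℚ.neg-antimono-≤ y≤ε) ⟩
  1ℚ - y       ≡⟨ cong (_- y) x+y≡1 ⟨
  x + y - y    ≡⟨ ℚ.+-assoc x y (- y) ⟩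
  x + (y - y)  ≡⟨ cong (x +_) (ℚ.+-inverseʳ y) ⟩
  x + 0ℚ       ≡⟨ ℚ.+-identityʳ x ⟩
  x            ∎
  where open ℚ.≤-Reasoning

count : ∀ {A : Set} → (A → Bool) → List A → ℕ
count p []       = 0
count p (x ∷ xs) = if p x then suc (count p xs) else count p xs

module _ {A : Set} where

  count-++ : ∀ (p : A → Bool) xs ys → count p (xs ++ ys) ≡ count p xs ℕ.+ count p ys
  count-++ p []       ys = refl
  count-++ p (x ∷ xs) ys with p x
  ... | true  = cong suc (count-++ p xs ys)
  ... | false = count-++ p xs ys

  count-map : ∀ {B : Set} (p : B → Bool) (f : A → B) xs → count p (map f xs) ≡ count (p ∘ f) xs
  count-map p f []       = refl
  count-map p f (x ∷ xs) with p (f x)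
  ... | true  = cong suc (count-map p f xs)
  ... | false = count-map p f xs

  count-cong : ∀ {p q : A → Bool} → (∀ x → p x ≡ q x) → ∀ xs → count p xs ≡ count q xs
  count-cong         p≗q []       = refl
  count-cong {q = q} p≗q (x ∷ xs) rewrite p≗q x with q x
  ... | true  = cong suc (count-cong p≗q xs)
  ... | false = count-cong p≗q xs

  count-false : ∀ (xs : List A) → count (λ _ → false) xs ≡ 0
  count-false []       = refl
  count-false (x ∷ xs) = count-false xs

  count-true : ∀ (xs : List A) → count (λ _ → true) xs ≡ length xs
  count-true []       = refl
  count-true (x ∷ xs) = cong suc (count-true xs)

  count-not+count : ∀ (p : A → Bool) xs → count (not ∘ p) xs ℕ.+ count p xs ≡ length xs
  count-not+count p []       = refl
  count-not+count p (x ∷ xs) with p x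
  ... | true  = trans (ℕ.+-suc _ _) (cong suc (count-not+count p xs))
  ... | false = cong suc (count-not+count p xs)

count-cartesianProductWith : ∀ {A B C : Set} {p : A → Bool} {q : B → Bool} {r : C → Bool}
  {f : A → B → C} → (∀ u v → r (f u v) ≡ p u ∧ q v) →
  ∀ us vs → count r (cartesianProductWith f us vs) ≡ count p us ℕ.* count q vs
count-cartesianProductWith                         r∘f≡p∧q []       vs = refl
count-cartesianProductWith {p = p} {q} {r} {f} r∘f≡p∧q (u ∷ us) vs = begin
  count r (map (f u) vs ++ cartesianProductWith f us vs)
    ≡⟨ count-++ r (map (f u) vs) _ ⟩
  count r (map (f u) vs) ℕ.+ count r (cartesianProductWith f us vs)
    ≡⟨ cong₂ ℕ._+_ (trans (count-map r (f u) vs) (count-cong (r∘f≡p∧q u) vs))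
                   (count-cartesianProductWith r∘f≡p∧q us vs) ⟩
  count (λ v → p u ∧ q v) vs ℕ.+ count p us ℕ.* count q vs
    ≡⟨ split (p u) ⟩
  count p (u ∷ us) ℕ.* count q vs  ∎
  where
  open ≡-Reasoning
  split : ∀ b → count (λ v → b ∧ q v) vs ℕ.+ count p us ℕ.* count q vs ≡
                (if b then suc (count p us) else count p us) ℕ.* count q vs
  split true  = refl
  split false = cong (ℕ._+ count p us ℕ.* count q vs) (count-false vs)

length-++-map : ∀ {A : Set} (f : A → A) xs → length (xs ++ map f xs) ≡ 2 ℕ.* length xs
length-++-map f xs = begin
  length (xs ++ map f xs)               ≡⟨ length-++ xs ⟩
  length xs ℕ.+ length (map f xs)       ≡⟨ cong (length xs ℕ.+_) (length-map f xs) ⟩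
  length xs ℕ.+ length xs               ≡⟨ cong (length xs ℕ.+_) (ℕ.+-identityʳ (length xs)) ⟨
  2 ℕ.* length xs                       ∎
  where open ≡-Reasoning

open CommutativeMonoidSum ℕ.+-0-commutativeMonoid using (sum; sum-remove; sum-cong-≗)

sum-const : ∀ n c → sum {n} (λ _ → c) ≡ n ℕ.* c
sum-const zero    c = refl
sum-const (suc n) c = cong (c ℕ.+_) (sum-const n c)

≤-sum : ∀ {n} (t : Vector ℕ n) i → t i ℕ.≤ sum t
≤-sum {suc n} t i = ℕ.≤-trans (ℕ.m≤m+n (t i) _) (ℕ.≤-reflexive (sym (sum-remove {i = i} t)))

sum-single : ∀ {n} (t : Vector ℕ (suc n)) i {c d} → t i ≡ c → (∀ j → j ≢ i → t j ≡ d) →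
             sum t ≡ c ℕ.+ n ℕ.* d
sum-single {n} t i {c} {d} tᵢ≡c t≡d = begin
  sum t                          ≡⟨ sum-remove {i = i} t ⟩
  t i ℕ.+ sum (removeAt t i)     ≡⟨ cong₂ ℕ._+_ tᵢ≡c (sum-cong-≗ λ j → t≡d _ (punchInᵢ≢i i j)) ⟩
  c ℕ.+ sum {n} (λ _ → d)        ≡⟨ cong (c ℕ.+_) (sum-const n d) ⟩
  c ℕ.+ n ℕ.* d                  ∎
  where open ≡-Reasoning

count-concat-tabulate : ∀ {A : Set} {n} (p : A → Bool) (f : Fin n → List A) →
                        count p (concat (tabulate f)) ≡ sum (count p ∘ f)
count-concat-tabulate {n = zero}  p f = refl
count-concat-tabulate {n = suc n} p f =
  trans (count-++ p (f zero) _) (cong (count p (f zero) ℕ.+_) (count-concat-tabulate p (f ∘ suc)))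

-- Parities and the splitting of an equation along X ⊔ Y

xor-interchange : ∀ p q r s → (p xor q) xor (r xor s) ≡ (p xor r) xor (q xor s)
xor-interchange = CommutativeSemigroupProperties.interchange
  (CommutativeRing.+-commutativeSemigroup xor-∧-commutativeRing)

∧-interchange : ∀ p q r s → (p ∧ q) ∧ (r ∧ s) ≡ (p ∧ r) ∧ (q ∧ s)
∧-interchange = CommutativeSemigroupProperties.interchange
  (CommutativeMonoid.commutativeSemigroup ∧-commutativeMonoid)

parity-xor : ∀ {n} (I : Subset n) {α β γ : Assignment n} → (∀ i → α i ≡ β i xor γ i) →
             parity I α ≡ parity I β xor parity I γ
parity-xor Vec.[]      α≡β⊕γ = refl
parity-xor (c Vec.∷ I) {α} {β} {γ} α≡β⊕γ = begin
  (c ∧ α zero) xor parity I (α ∘ suc)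
    ≡⟨ cong₂ (λ u v → (c ∧ u) xor v) (α≡β⊕γ zero) (parity-xor I (α≡β⊕γ ∘ suc)) ⟩
  (c ∧ (β zero xor γ zero)) xor (parity I (β ∘ suc) xor parity I (γ ∘ suc))
    ≡⟨ cong (_xor _) (∧-distribˡ-xor c (β zero) (γ zero)) ⟩
  ((c ∧ β zero) xor (c ∧ γ zero)) xor (parity I (β ∘ suc) xor parity I (γ ∘ suc))
    ≡⟨ xor-interchange (c ∧ β zero) (c ∧ γ zero) _ _ ⟩
  ((c ∧ β zero) xor parity I (β ∘ suc)) xor ((c ∧ γ zero) xor parity I (γ ∘ suc))  ∎
  where open ≡-Reasoning

parity-∅ : ∀ {n} (α : Assignment n) → parity (Vec.replicate n false) α ≡ false
parity-∅ {zero}  α = refl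
parity-∅ {suc n} α = parity-∅ (α ∘ suc)

module _ {n a b : ℕ} (e : Fin n ↔ (Fin a ⊎ Fin b)) where

  xPart : Equation n → Assignment a → Bool
  xPart (I , _) x = parity I (join e x (λ _ → false))

  yPart : Equation n → Assignment b → Bool
  yPart (I , c) y = not (parity I (join e (λ _ → false) y) xor c)

  join-xor : ∀ x y i → join e x y i ≡ join e x (λ _ → false) i xor join e (λ _ → false) y i
  join-xor x y i with Inverse.to e i
  ... | inj₁ k = sym (xor-identityʳ (x k))
  ... | inj₂ k = refl

  satEqᵇ-join : ∀ E x y → satEqᵇ E (join e x y) ≡ xPart E x xor yPart E y
  satEqᵇ-join (I , c) x y = begin
    not (parity I (join e x y) xor c)  ≡⟨ cong (λ u → not (u xor c)) (parity-xor I (join-xor x y)) ⟩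
    not ((p xor q) xor c)              ≡⟨ cong not (xor-assoc p q c) ⟩
    not (p xor (q xor c))              ≡⟨ not-distribʳ-xor p (q xor c) ⟩
    p xor not (q xor c)                ∎
    where
    open ≡-Reasoning
    p = parity I (join e x (λ _ → false))
    q = parity I (join e (λ _ → false) y)

subsetXors : List Bool → List Bool
subsetXors []       = false ∷ []
subsetXors (b ∷ bs) = subsetXors bs ++ map (b xor_) (subsetXors bs)

length-subsetXors : ∀ bs → length (subsetXors bs) ≡ 2 ^ length bs
length-subsetXors []       = refl
length-subsetXors (b ∷ bs) =
  trans (length-++-map (b xor_) (subsetXors bs)) (cong (2 ℕ.*_) (length-subsetXors bs))

count-subsetXors-∷ : ∀ p b bs → count p (subsetXors (b ∷ bs)) ≡
                     count p (subsetXors bs) ℕ.+ count (p ∘ (b xor_)) (subsetXors bs)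
count-subsetXors-∷ p b bs =
  trans (count-++ p (subsetXors bs) _) (cong (count p (subsetXors bs) ℕ.+_) (count-map p (b xor_) (subsetXors bs)))

subsetXors-or≡false : ∀ bs → or bs ≡ false → count id (subsetXors bs) ≡ 0
subsetXors-or≡false []          _ = refl
subsetXors-or≡false (false ∷ bs) h = begin
  count id (subsetXors (false ∷ bs))                     ≡⟨ count-subsetXors-∷ id false bs ⟩
  count id (subsetXors bs) ℕ.+ count id (subsetXors bs)  ≡⟨ cong₂ ℕ._+_ ih ih ⟩
  0                                                      ∎
  where
  open ≡-Reasoning
  ih = subsetXors-or≡false bs h

subsetXors-or≡true : ∀ bs → or bs ≡ true → count not (subsetXors bs) ≡ count id (subsetXors bs)
subsetXors-or≡true (true ∷ bs)  _ = begin
  count not (subsetXors (true ∷ bs))       ≡⟨ count-subsetXors-∷ not true bs ⟩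
  Z ℕ.+ count (not ∘ not) (subsetXors bs)  ≡⟨ cong (Z ℕ.+_) (count-cong not-involutive (subsetXors bs)) ⟩
  Z ℕ.+ O                                  ≡⟨ ℕ.+-comm Z O ⟩
  O ℕ.+ Z                                  ≡⟨ count-subsetXors-∷ id true bs ⟨
  count id (subsetXors (true ∷ bs))        ∎
  where
  open ≡-Reasoning
  Z = count not (subsetXors bs)
  O = count id (subsetXors bs)
subsetXors-or≡true (false ∷ bs) h = begin
  count not (subsetXors (false ∷ bs))                       ≡⟨ count-subsetXors-∷ not false bs ⟩
  count not (subsetXors bs) ℕ.+ count not (subsetXors bs)   ≡⟨ cong₂ ℕ._+_ ih ih ⟩
  count id (subsetXors bs) ℕ.+ count id (subsetXors bs)     ≡⟨ count-subsetXors-∷ id false bs ⟨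
  count id (subsetXors (false ∷ bs))                        ∎
  where
  open ≡-Reasoning
  ih = subsetXors-or≡true bs h

even-subsetXors-or≡false : ∀ bs → or bs ≡ false → count not (subsetXors bs) ≡ 2 ^ length bs
even-subsetXors-or≡false bs h = begin
  count not (subsetXors bs)                                ≡⟨ ℕ.+-identityʳ _ ⟨
  count not (subsetXors bs) ℕ.+ 0                          ≡⟨ cong (Z ℕ.+_) (subsetXors-or≡false bs h) ⟨
  count not (subsetXors bs) ℕ.+ count id (subsetXors bs)   ≡⟨ count-not+count id (subsetXors bs) ⟩
  length (subsetXors bs)                                   ≡⟨ length-subsetXors bs ⟩
  2 ^ length bs                                            ∎
  where
  open ≡-Reasoning
  Z = count not (subsetXors bs)

even-subsetXors-or≡true : ∀ bs → or bs ≡ true → 2 ℕ.* count not (subsetXors bs) ≡ 2 ^ length bs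
even-subsetXors-or≡true bs h = begin
  2 ℕ.* count not (subsetXors bs)                          ≡⟨ cong (Z ℕ.+_) (ℕ.+-identityʳ Z) ⟩
  count not (subsetXors bs) ℕ.+ count not (subsetXors bs)  ≡⟨ cong (Z ℕ.+_) (subsetXors-or≡true bs h) ⟩
  count not (subsetXors bs) ℕ.+ count id (subsetXors bs)   ≡⟨ count-not+count id (subsetXors bs) ⟩
  length (subsetXors bs)                                   ≡⟨ length-subsetXors bs ⟩
  2 ^ length bs                                            ∎
  where
  open ≡-Reasoning
  Z = count not (subsetXors bs)

module _ {a b : ℕ} where

  _∩ᴿ_ : Rect a b → Rect a b → Rect a b
  rect A B ∩ᴿ rect A′ B′ = rect (λ x → A x ∧ A′ x) (λ y → B y ∧ B′ y)

  fullRect : Rect a b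
  fullRect = rect (λ _ → true) (λ _ → true)

  inRectᵇ-∩ᴿ : ∀ x y R R′ → inRectᵇ x y (R ∩ᴿ R′) ≡ inRectᵇ x y R ∧ inRectᵇ x y R′
  inRectᵇ-∩ᴿ x y (rect A B) (rect A′ B′) = ∧-interchange (A x) (A′ x) (B y) (B′ y)

  intersections : ℕ → List (Rect a b) → List (Rect a b)
  intersections zero    Rs = fullRect ∷ []
  intersections (suc t) Rs = cartesianProductWith _∩ᴿ_ Rs (intersections t Rs)

  count-intersections : ∀ {p : Rect a b → Bool} → p fullRect ≡ true →
    (∀ R R′ → p (R ∩ᴿ R′) ≡ p R ∧ p R′) → ∀ t Rs → count p (intersections t Rs) ≡ count p Rs ^ t
  count-intersections     p-full p-∩ zero    Rs rewrite p-full = refl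
  count-intersections {p} p-full p-∩ (suc t) Rs =
    trans (count-cartesianProductWith p-∩ Rs (intersections t Rs))
          (cong (count p Rs ℕ.*_) (count-intersections p-full p-∩ t Rs))

  SplitFun : Set
  SplitFun = (Assignment a → Bool) × (Assignment b → Bool)

  applySplit : SplitFun → Assignment a → Assignment b → Bool
  applySplit (f , g) x y = f x xor g y

  zeroRects : List SplitFun → List (Rect a b)
  zeroRects []            = []
  zeroRects ((f , g) ∷ hs) = rect (not ∘ f) (not ∘ g) ∷ rect f g ∷ zeroRects hs

  count-zeroRects : ∀ x y hs → count (inRectᵇ x y) (zeroRects hs) ≡ count (λ h → not (applySplit h x y)) hs
  count-zeroRects x y []            = refl
  count-zeroRects x y ((f , g) ∷ hs) with f x | g y
  ... | false | false = cong suc (count-zeroRects x y hs)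
  ... | false | true  = count-zeroRects x y hs
  ... | true  | false = count-zeroRects x y hs
  ... | true  | true  = cong suc (count-zeroRects x y hs)

  length-zeroRects : ∀ hs → length (zeroRects hs) ≡ 2 ℕ.* length hs
  length-zeroRects []       = refl
  length-zeroRects (_ ∷ hs) = trans (cong (λ k → 2 ℕ.+ k) (length-zeroRects hs)) (sym (ℕ.*-suc 2 (length hs)))

module _ {n : ℕ} (α : Assignment n) where

  falsifiesᵇ≡not-or : ∀ C → falsifiesᵇ α C ≡ not (or (map (λ E → satEqᵇ E α) C))
  falsifiesᵇ≡not-or []      = refl
  falsifiesᵇ≡not-or (E ∷ C) with satEqᵇ E α
  ... | true  = refl
  ... | false = falsifiesᵇ≡not-or C

  Falsifies⇒unsat : ∀ {C E} → Falsifies α C → E ∈ C → satEqᵇ E α ≡ false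
  Falsifies⇒unsat {E ∷ C} α⊭C (here refl) with satEqᵇ E α
  ... | false = refl
  Falsifies⇒unsat {E ∷ C} () (here refl) | true
  Falsifies⇒unsat {E′ ∷ C} α⊭C (there E∈C) with satEqᵇ E′ α
  ... | false = Falsifies⇒unsat α⊭C E∈C
  Falsifies⇒unsat {E′ ∷ C} () (there E∈C) | true

  unsat⇒Falsifies : ∀ {C} → (∀ {E} → E ∈ C → satEqᵇ E α ≡ false) → Falsifies α C
  unsat⇒Falsifies {[]}    _     = refl
  unsat⇒Falsifies {E ∷ C} unsat rewrite unsat (here refl) = unsat⇒Falsifies (unsat ∘ there)

  Falsifies-⊆ᶜ : ∀ {C′ C} → C′ ⊆ᶜ C → Falsifies α C → Falsifies α C′
  Falsifies-⊆ᶜ C′⊆C α⊭C = unsat⇒Falsifies (Falsifies⇒unsat α⊭C ∘ C′⊆C)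

unsatEquation : ∀ {n} → Equation n
unsatEquation {n} = Vec.replicate n false , true

satEqᵇ-unsatEquation : ∀ {n} (α : Assignment n) → satEqᵇ unsatEquation α ≡ false
satEqᵇ-unsatEquation α rewrite parity-∅ α = refl

padTo : ∀ {n} → ℕ → Clause n → Clause n
padTo l C = replicate (l ∸ length C) unsatEquation ++ C

length-padTo : ∀ {n} {l} (C : Clause n) → length C ℕ.≤ l → length (padTo l C) ≡ l
length-padTo {l = l} C C≤l = begin
  length (padding ++ C)               ≡⟨ length-++ padding ⟩
  length padding ℕ.+ length C         ≡⟨ cong (ℕ._+ length C) (length-replicate (l ∸ length C)) ⟩
  l ∸ length C ℕ.+ length C           ≡⟨ ℕ.m∸n+n≡m C≤l ⟩
  l                                   ∎
  where
  open ≡-Reasoning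
  padding = replicate (l ∸ length C) unsatEquation

falsifiesᵇ-padTo : ∀ {n} (α : Assignment n) l C → falsifiesᵇ α (padTo l C) ≡ falsifiesᵇ α C
falsifiesᵇ-padTo α l C = go (l ∸ length C)
  where
  go : ∀ r → falsifiesᵇ α (replicate r unsatEquation ++ C) ≡ falsifiesᵇ α C
  go zero    = refl
  go (suc r) rewrite satEqᵇ-unsatEquation α = go r

module _ {n a b : ℕ} (e : Fin n ↔ (Fin a ⊎ Fin b)) where

  shiftSplit : Equation n → SplitFun → SplitFun
  shiftSplit E (f , g) = (λ x → xPart e E x xor f x) , (λ y → yPart e E y xor g y)

  subsetSplits : Clause n → List SplitFun
  subsetSplits []      = ((λ _ → false) , (λ _ → false)) ∷ []
  subsetSplits (E ∷ C) = subsetSplits C ++ map (shiftSplit E) (subsetSplits C)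

  clauseRects : Clause n → List (Rect a b)
  clauseRects C = zeroRects (subsetSplits C)

  length-subsetSplits : ∀ C → length (subsetSplits C) ≡ 2 ^ length C
  length-subsetSplits []      = refl
  length-subsetSplits (E ∷ C) =
    trans (length-++-map (shiftSplit E) (subsetSplits C)) (cong (2 ℕ.*_) (length-subsetSplits C))

  length-clauseRects : ∀ C → length (clauseRects C) ≡ 2 ℕ.* 2 ^ length C
  length-clauseRects C = trans (length-zeroRects (subsetSplits C)) (cong (2 ℕ.*_) (length-subsetSplits C))

  module _ (x : Assignment a) (y : Assignment b) where

    truthValues : Clause n → List Bool
    truthValues = map (λ E → satEqᵇ E (join e x y))

    length-truthValues : ∀ C → length (truthValues C) ≡ length C
    length-truthValues = length-map (λ E → satEqᵇ E (join e x y))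

    applySplit-shiftSplit : ∀ E h → applySplit (shiftSplit E h) x y ≡ satEqᵇ E (join e x y) xor applySplit h x y
    applySplit-shiftSplit E (f , g) =
      trans (xor-interchange (xPart e E x) (f x) (yPart e E y) (g y))
            (cong (_xor (f x xor g y)) (sym (satEqᵇ-join e E x y)))

    applySplit-subsetSplits : ∀ C → map (λ h → applySplit h x y) (subsetSplits C) ≡ subsetXors (truthValues C)
    applySplit-subsetSplits []      = refl
    applySplit-subsetSplits (E ∷ C) = begin
      map app (hs ++ map (shiftSplit E) hs)        ≡⟨ map-++ app hs _ ⟩
      map app hs ++ map app (map (shiftSplit E) hs)  ≡⟨ cong (map app hs ++_) shifted ⟩
      map app hs ++ map (sat xor_) (map app hs)      ≡⟨ cong (λ vs → vs ++ map (sat xor_) vs) ih ⟩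
      subsetXors (truthValues (E ∷ C))              ∎
      where
      open ≡-Reasoning
      app = λ h → applySplit h x y
      sat = satEqᵇ E (join e x y)
      hs  = subsetSplits C
      shifted : map app (map (shiftSplit E) hs) ≡ map (sat xor_) (map app hs)
      shifted = trans (sym (map-∘ hs)) (trans (map-cong (applySplit-shiftSplit E) hs) (map-∘ hs))
      ih = applySplit-subsetSplits C

    count-clauseRects : ∀ C → count (inRectᵇ x y) (clauseRects C) ≡ count not (subsetXors (truthValues C))
    count-clauseRects C = begin
      count (inRectᵇ x y) (zeroRects (subsetSplits C))             ≡⟨ count-zeroRects x y (subsetSplits C) ⟩
      count (λ h → not (applySplit h x y)) (subsetSplits C)        ≡⟨ count-map not _ (subsetSplits C) ⟨
      count not (map (λ h → applySplit h x y) (subsetSplits C))    ≡⟨ cong (count not) (applySplit-subsetSplits C) ⟩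
      count not (subsetXors (truthValues C))                       ∎
      where open ≡-Reasoning

    count-clauseRects-falsifiesᵇ : ∀ C {k} → length C ≡ suc k →
      count (inRectᵇ x y) (clauseRects C) ≡ (if falsifiesᵇ (join e x y) C then 2 ^ suc k else 2 ^ k)
    count-clauseRects-falsifiesᵇ C {k} |C|≡1+k
      rewrite falsifiesᵇ≡not-or (join e x y) C | count-clauseRects C
      with or (truthValues C) in or≡
    ... | false = trans (even-subsetXors-or≡false (truthValues C) or≡)
                        (cong (2 ^_) (trans (length-truthValues C) |C|≡1+k))
    ... | true  = ℕ.*-cancelˡ-≡ _ _ 2 (trans (even-subsetXors-or≡true (truthValues C) or≡)
                                          (cong (2 ^_) (trans (length-truthValues C) |C|≡1+k)))

^-distribʳ-* : ∀ m n o → (m ℕ.* n) ^ o ≡ m ^ o ℕ.* n ^ o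
^-distribʳ-* m n zero    = refl
^-distribʳ-* m n (suc o) = trans (cong (m ℕ.* n ℕ.*_) (^-distribʳ-* m n o))
  (CommutativeSemigroupProperties.interchange ℕ.*-commutativeSemigroup m n (m ^ o) (n ^ o))

2^-between : ∀ N .{{_ : NonZero N}} → ∃ λ t → N ℕ.≤ 2 ^ t × 2 ^ t ℕ.≤ 2 ℕ.* N
2^-between 1 = 0 , ℕ.≤-refl , ℕ.s≤s ℕ.z≤n
2^-between (suc (suc N)) with 2^-between (suc N)
... | t , 1+N≤2^t , 2^t≤2+2N with suc (suc N) ℕ.≤? 2 ^ t
...   | yes 2+N≤2^t = t , 2+N≤2^t , ℕ.≤-trans 2^t≤2+2N (ℕ.*-monoʳ-≤ 2 (ℕ.n≤1+n (suc N)))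
...   | no  2+N≰2^t = suc t , 2+N≤2*2^t , ℕ.*-monoʳ-≤ 2 (ℕ.≤-trans 2^t≤1+N (ℕ.n≤1+n (suc N)))
  where
  2^t≤1+N : 2 ^ t ℕ.≤ suc N
  2^t≤1+N = ℕ.≤-pred (ℕ.≰⇒> 2+N≰2^t)

  2+N≤2*2^t : suc (suc N) ℕ.≤ 2 ℕ.* 2 ^ t
  2+N≤2*2^t = begin
    2 ℕ.+ N        ≤⟨ ℕ.+-monoʳ-≤ 2 (ℕ.m≤n*m N 2) ⟩
    2 ℕ.+ 2 ℕ.* N  ≡⟨ ℕ.*-suc 2 N ⟨
    2 ℕ.* suc N    ≤⟨ ℕ.*-monoʳ-≤ 2 1+N≤2^t ⟩
    2 ℕ.* 2 ^ t    ∎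
    where open ℕ.≤-Reasoning

error-numerator-≤ : ∀ s′ q T B → suc s′ ℕ.* q ℕ.≤ T →
                    s′ ℕ.* B ℕ.* q ℕ.≤ 1 ℕ.* (T ℕ.* B ℕ.+ s′ ℕ.* B)
error-numerator-≤ s′ q T B sq≤T = begin
  s′ ℕ.* B ℕ.* q                ≡⟨ xy∙z≈xz∙y s′ B q ⟩
  s′ ℕ.* q ℕ.* B                ≤⟨ ℕ.*-monoˡ-≤ B (ℕ.≤-trans (ℕ.*-monoˡ-≤ q (ℕ.n≤1+n s′)) sq≤T) ⟩
  T ℕ.* B                       ≤⟨ ℕ.m≤m+n (T ℕ.* B) (s′ ℕ.* B) ⟩
  T ℕ.* B ℕ.+ s′ ℕ.* B          ≡⟨ ℕ.*-identityˡ _ ⟨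
  1 ℕ.* (T ℕ.* B ℕ.+ s′ ℕ.* B)  ∎
  where
  open ℕ.≤-Reasoning
  open CommutativeSemigroupProperties ℕ.*-commutativeSemigroup using (xy∙z≈xz∙y)

cost-numerator-≤ : ∀ s q T B s′ → T ℕ.≤ 2 ℕ.* (s ℕ.* q) →
  s ℕ.* (T ℕ.* (T ℕ.* B)) ℕ.* 1 ℕ.≤ 2 ℕ.* q ℕ.* (s ℕ.* s) ℕ.* (T ℕ.* B ℕ.+ s′ ℕ.* B)
cost-numerator-≤ s q T B s′ T≤2sq = begin
  s ℕ.* (T ℕ.* (T ℕ.* B)) ℕ.* 1              ≡⟨ ℕ.*-identityʳ _ ⟩
  s ℕ.* (T ℕ.* (T ℕ.* B))                    ≡⟨ x∙yz≈y∙xz s T (T ℕ.* B) ⟩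
  T ℕ.* (s ℕ.* (T ℕ.* B))                    ≤⟨ ℕ.*-mono-≤ T≤2sq (ℕ.*-monoʳ-≤ s (ℕ.m≤m+n _ (s′ ℕ.* B))) ⟩
  2 ℕ.* (s ℕ.* q) ℕ.* (s ℕ.* Q)              ≡⟨ rearrange s q Q ⟩
  2 ℕ.* q ℕ.* (s ℕ.* s) ℕ.* Q                ∎
  where
  open ℕ.≤-Reasoning
  open CommutativeSemigroupProperties ℕ.*-commutativeSemigroup using (x∙yz≈y∙xz)
  Q = T ℕ.* B ℕ.+ s′ ℕ.* B
  rearrange : ∀ s q Q → 2 ℕ.* (s ℕ.* q) ℕ.* (s ℕ.* Q) ≡ 2 ℕ.* q ℕ.* (s ℕ.* s) ℕ.* Q
  rearrange = solve-∀

-- The weights of a hitting refutation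

module _ {m a b : ℕ} {w : ℚ} where

  sumWhere-uniform : ∀ (c : Entry m a b → Bool) {L} → All (λ en → Entry.weight en ≡ w) L →
                     sumWhere c L ≡ ℕtoℚ (count c L) * w
  sumWhere-uniform c                All.[]         = sym (ℚ.*-zeroˡ w)
  sumWhere-uniform c {en ∷ L} (w≡ All.∷ ws) with c en
  ... | true  = trans (cong₂ _+_ w≡ (sumWhere-uniform c ws)) (sym (ℕtoℚ-suc-* (count c L) w))
  ... | false = trans (ℚ.+-identityˡ _) (sumWhere-uniform c ws)

  total-uniform : ∀ {L : Weights m a b} → All (λ en → Entry.weight en ≡ w) L → total L ≡ ℕtoℚ (length L) * w
  total-uniform {L} ws = trans (sumWhere-uniform (λ _ → true) ws) (cong (λ k → ℕtoℚ k * w) (count-true L))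

  nonneg-uniform : ∀ {L : Weights m a b} → 0ℚ ≤ w → All (λ en → Entry.weight en ≡ w) L → Nonneg L
  nonneg-uniform 0≤w = All.map (λ w≡ → subst (0ℚ ≤_) (sym w≡) 0≤w)

module _ {n m s′ a b : ℕ} {F : Fin m → Clause n} {H : Fin (suc s′) → Clause n}
         (ref : IsHittingRefutation F H) (e : Fin n ↔ (Fin a ⊎ Fin b)) where

  private
    hitting = proj₁ ref
    unsat   = proj₁ (proj₂ ref)
    weakens = proj₂ (proj₂ ref)

  parent : Fin (suc s′) → Fin m
  parent j = proj₁ (weakens j)

  falsified : Assignment a → Assignment b → Fin (suc s′)
  falsified x y = proj₁ (unsat (join e x y))

  falsifiesᵇ-falsified : ∀ x y → falsifiesᵇ (join e x y) (H (falsified x y)) ≡ true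
  falsifiesᵇ-falsified x y = proj₂ (unsat (join e x y))

  falsifiesᵇ-parent-falsified : ∀ x y → falsifiesᵇ (join e x y) (F (parent (falsified x y))) ≡ true
  falsifiesᵇ-parent-falsified x y =
    Falsifies-⊆ᶜ (join e x y) (proj₂ (weakens (falsified x y))) (falsifiesᵇ-falsified x y)

  falsifiesᵇ-≢falsified : ∀ x y j → j ≢ falsified x y → falsifiesᵇ (join e x y) (H j) ≡ false
  falsifiesᵇ-≢falsified x y j j≢ with falsifiesᵇ (join e x y) (H j) in α⊭Hj
  ... | true  = ⊥-elim (hitting j (falsified x y) j≢ (join e x y) (α⊭Hj , falsifiesᵇ-falsified x y))
  ... | false = refl

  correctᵇ : Assignment a → Assignment b → Entry m a b → Bool
  correctᵇ x y en = falsifiesᵇ (join e x y) (F (Entry.out en)) ∧ inRectᵇ x y (Entry.rectangle en)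

  Covers : (Fin (suc s′) → List (Rect a b)) → ℕ → ℕ → Set
  Covers R A B = ∀ j x y → count (inRectᵇ x y) (R j) ≡ (if falsifiesᵇ (join e x y) (H j) then A else B)

  module UniformWeights (R : Fin (suc s′) → List (Rect a b)) (w : ℚ) where

    toEntry : Fin (suc s′) → Rect a b → Entry m a b
    toEntry j Q = entry (parent j) Q w

    block : Fin (suc s′) → Weights m a b
    block j = map (toEntry j) (R j)

    weights : Weights m a b
    weights = concat (tabulate block)

    weights-uniform : All (λ en → Entry.weight en ≡ w) weights
    weights-uniform =
      All.concat⁺ (All.tabulate⁺ λ j → All.map⁺ {f = toEntry j} (All.universal (λ _ → refl) (R j)))

    count-weights : ∀ p → count p weights ≡ sum (λ j → count (p ∘ toEntry j) (R j))
    count-weights p = trans (count-concat-tabulate p block) (sum-cong-≗ λ j → count-map p (toEntry j) (R j))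

    module _ {A B : ℕ} (cov : Covers R A B) (x : Assignment a) (y : Assignment b) where

      private
        j* = falsified x y

      count-inRect-falsified : count (inRectᵇ x y) (R j*) ≡ A
      count-inRect-falsified = trans (cov j* x y) (cong (if_then A else B) (falsifiesᵇ-falsified x y))

      count-inRect-≢falsified : ∀ j → j ≢ j* → count (inRectᵇ x y) (R j) ≡ B
      count-inRect-≢falsified j j≢j* =
        trans (cov j x y) (cong (if_then A else B) (falsifiesᵇ-≢falsified x y j j≢j*))

      count-inRect-weights : count (inRectᵇ x y ∘ Entry.rectangle) weights ≡ A ℕ.+ s′ ℕ.* B
      count-inRect-weights =
        trans (count-weights (inRectᵇ x y ∘ Entry.rectangle))
              (sum-single (λ j → count (inRectᵇ x y) (R j)) j* count-inRect-falsified count-inRect-≢falsified)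

      ≤-count-correct-weights : A ℕ.≤ count (correctᵇ x y) weights
      ≤-count-correct-weights = begin
        A  ≡⟨ count-inRect-falsified ⟨
        count (inRectᵇ x y) (R j*)
          ≡⟨ cong (λ c → count (λ Q → c ∧ inRectᵇ x y Q) (R j*)) (falsifiesᵇ-parent-falsified x y) ⟨
        count (correctᵇ x y ∘ toEntry j*) (R j*)
          ≤⟨ ≤-sum (λ j → count (correctᵇ x y ∘ toEntry j) (R j)) j* ⟩
        sum (λ j → count (correctᵇ x y ∘ toEntry j) (R j))
          ≡⟨ count-weights (correctᵇ x y) ⟨
        count (correctᵇ x y) weights  ∎
        where open ℕ.≤-Reasoning

    length-weights : ∀ {Λ} → (∀ j → length (R j) ≡ Λ) → length weights ≡ suc s′ ℕ.* Λ
    length-weights {Λ} |R|≡Λ = begin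
      length weights                                ≡⟨ count-true weights ⟨
      count (λ _ → true) weights                    ≡⟨ count-weights (λ _ → true) ⟩
      sum (λ j → count (λ _ → true) (R j))          ≡⟨ sum-cong-≗ (λ j → trans (count-true (R j)) (|R|≡Λ j)) ⟩
      sum {suc s′} (λ _ → Λ)                         ≡⟨ sum-const (suc s′) Λ ⟩
      suc s′ ℕ.* Λ                                  ∎
      where open ≡-Reasoning

  uniformWeights-feasible : ∀ {R A B ε} .{{_ : NonZero (A ℕ.+ s′ ℕ.* B)}} → Covers R A B →
    ℕtoℚ (s′ ℕ.* B) * recip (A ℕ.+ s′ ℕ.* B) ≤ ε →
    Feasible ε F e (UniformWeights.weights R (recip (A ℕ.+ s′ ℕ.* B)))
  uniformWeights-feasible {R} {A} {B} {ε} cov s′B/Q≤ε =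
    nonneg-uniform (ℚ.nonNegative⁻¹ w {{recip-nonNeg Q}}) weights-uniform , correct , inRect
    where
    Q = A ℕ.+ s′ ℕ.* B
    w = recip Q
    open UniformWeights R w

    A/Q+s′B/Q≡1 : ℕtoℚ A * w + ℕtoℚ (s′ ℕ.* B) * w ≡ 1ℚ
    A/Q+s′B/Q≡1 = begin
      ℕtoℚ A * w + ℕtoℚ (s′ ℕ.* B) * w   ≡⟨ ℚ.*-distribʳ-+ w (ℕtoℚ A) _ ⟨
      (ℕtoℚ A + ℕtoℚ (s′ ℕ.* B)) * w     ≡⟨ cong (_* w) (ℕtoℚ-+ A (s′ ℕ.* B)) ⟨
      ℕtoℚ Q * w                         ≡⟨ ℕtoℚ*recip≡1 Q ⟩
      1ℚ                                 ∎
      where open ≡-Reasoning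

    inRect : ∀ x y → sumWhere (λ en → inRectᵇ x y (Entry.rectangle en)) weights ≡ 1ℚ
    inRect x y = begin
      sumWhere (inRectᵇ x y ∘ Entry.rectangle) weights               ≡⟨ sumWhere-uniform _ weights-uniform ⟩
      ℕtoℚ (count (inRectᵇ x y ∘ Entry.rectangle) weights) * w
        ≡⟨ cong (λ k → ℕtoℚ k * w) (count-inRect-weights cov x y) ⟩
      ℕtoℚ Q * w                                                     ≡⟨ ℕtoℚ*recip≡1 Q ⟩
      1ℚ                                                             ∎
      where open ≡-Reasoning

    correct : ∀ x y → InSupp F e x y → 1ℚ - ε ≤ sumWhere (correctᵇ x y) weights
    correct x y _ = begin
      1ℚ - ε                                ≤⟨ x+y≡1⇒1-ε≤x A/Q+s′B/Q≡1 s′B/Q≤ε ⟩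
      ℕtoℚ A * w                            ≤⟨ ℚ.*-monoʳ-≤-nonNeg w {{recip-nonNeg Q}}
                                                 (ℕtoℚ-mono-≤ (≤-count-correct-weights cov x y)) ⟩
      ℕtoℚ (count (correctᵇ x y) weights) * w  ≡⟨ sumWhere-uniform (correctᵇ x y) weights-uniform ⟨
      sumWhere (correctᵇ x y) weights       ∎
      where open ℚ.≤-Reasoning

  paddedRects : ℕ → ℕ → Fin (suc s′) → List (Rect a b)
  paddedRects k t j = intersections t (clauseRects e (padTo (suc k) (H j)))

  module _ {k : ℕ} (|H|≤1+k : ∀ j → length (H j) ℕ.≤ suc k) (t : ℕ) where

    paddedRects-covers : Covers (paddedRects k t) (2 ^ t ℕ.* (2 ^ k) ^ t) ((2 ^ k) ^ t)
    paddedRects-covers j x y = begin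
      count (inRectᵇ x y) (intersections t (clauseRects e C))
        ≡⟨ count-intersections refl (inRectᵇ-∩ᴿ x y) t (clauseRects e C) ⟩
      count (inRectᵇ x y) (clauseRects e C) ^ t
        ≡⟨ cong (_^ t) (count-clauseRects-falsifiesᵇ e x y C (length-padTo (H j) (|H|≤1+k j))) ⟩
      (if falsifiesᵇ α C then 2 ^ suc k else 2 ^ k) ^ t
        ≡⟨ if-float (_^ t) (falsifiesᵇ α C) ⟩
      (if falsifiesᵇ α C then (2 ^ suc k) ^ t else (2 ^ k) ^ t)
        ≡⟨ cong₂ (if_then_else (2 ^ k) ^ t) (falsifiesᵇ-padTo α (suc k) (H j)) (^-distribʳ-* 2 (2 ^ k) t) ⟩
      (if falsifiesᵇ α (H j) then 2 ^ t ℕ.* (2 ^ k) ^ t else (2 ^ k) ^ t)  ∎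
      where
      open ≡-Reasoning
      α = join e x y
      C = padTo (suc k) (H j)

    length-paddedRects : ∀ j → length (paddedRects k t j) ≡ 2 ^ t ℕ.* (2 ^ t ℕ.* (2 ^ k) ^ t)
    length-paddedRects j = begin
      length (intersections t (clauseRects e C))                ≡⟨ count-true (intersections t (clauseRects e C)) ⟨
      count (λ _ → true) (intersections t (clauseRects e C))    ≡⟨ count-intersections refl (λ _ _ → refl) t _ ⟩
      count (λ _ → true) (clauseRects e C) ^ t                  ≡⟨ cong (_^ t) (count-true (clauseRects e C)) ⟩
      length (clauseRects e C) ^ t                              ≡⟨ cong (_^ t) (length-clauseRects e C) ⟩
      (2 ℕ.* 2 ^ length C) ^ t                                  ≡⟨ cong (λ l → (2 ℕ.* 2 ^ l) ^ t) |C|≡1+k ⟩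
      (2 ℕ.* (2 ℕ.* 2 ^ k)) ^ t                                 ≡⟨ ^-distribʳ-* 2 (2 ℕ.* 2 ^ k) t ⟩
      2 ^ t ℕ.* (2 ℕ.* 2 ^ k) ^ t                               ≡⟨ cong (2 ^ t ℕ.*_) (^-distribʳ-* 2 (2 ^ k) t) ⟩
      2 ^ t ℕ.* (2 ^ t ℕ.* (2 ^ k) ^ t)                         ∎
      where
      open ≡-Reasoning
      C = padTo (suc k) (H j)
      |C|≡1+k = length-padTo (H j) (|H|≤1+k j)

  partitionBound : ∀ {ε} q .{{_ : NonZero q}} → recip q ≤ ε →
    ∃ λ (L : Weights m a b) →
      Feasible ε F e L × total L ≤ ℕtoℚ (2 ℕ.* q) * (ℕtoℚ (suc s′) * ℕtoℚ (suc s′))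
  partitionBound {ε} q 1/q≤ε with 2^-between (suc s′ ℕ.* q) {{ℕ.m*n≢0 (suc s′) q}}
  ... | t , sq≤T , T≤2sq = weights , uniformWeights-feasible {R = paddedRects k t} cov s′B/Q≤ε , cost
    where
    s = suc s′
    k = sum (λ j → length (H j))
    T = 2 ^ t
    B = (2 ^ k) ^ t
    Q = T ℕ.* B ℕ.+ s′ ℕ.* B
    instance
      T≢0 : NonZero T
      T≢0 = ℕ.m^n≢0 2 t
      2^k≢0 : NonZero (2 ^ k)
      2^k≢0 = ℕ.m^n≢0 2 k
      B≢0 : NonZero B
      B≢0 = ℕ.m^n≢0 (2 ^ k) t
      Q≢0 : NonZero Q
      Q≢0 = ℕ.>-nonZero (ℕ.≤-trans (ℕ.>-nonZero⁻¹ (T ℕ.* B) {{ℕ.m*n≢0 T B}}) (ℕ.m≤m+n _ _))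
    |H|≤1+k : ∀ j → length (H j) ℕ.≤ suc k
    |H|≤1+k j = ℕ.≤-trans (≤-sum (λ j → length (H j)) j) (ℕ.n≤1+n k)
    cov : Covers (paddedRects k t) (T ℕ.* B) B
    cov = paddedRects-covers |H|≤1+k t
    open UniformWeights (paddedRects k t) (recip Q)

    s′B/Q≤ε : ℕtoℚ (s′ ℕ.* B) * recip Q ≤ ε
    s′B/Q≤ε = ℚ.≤-trans (ℕtoℚ*recip-mono-≤ (s′ ℕ.* B) Q 1 q (error-numerator-≤ s′ q T B sq≤T))
                       (subst (_≤ ε) (sym (ℚ.*-identityˡ (recip q))) 1/q≤ε)

    cost : total weights ≤ ℕtoℚ (2 ℕ.* q) * (ℕtoℚ s * ℕtoℚ s)
    cost = begin
      total weights                                  ≡⟨ total-uniform weights-uniform ⟩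
      ℕtoℚ (length weights) * recip Q                ≡⟨ cong (λ l → ℕtoℚ l * recip Q) |weights| ⟩
      ℕtoℚ (s ℕ.* (T ℕ.* (T ℕ.* B))) * recip Q
        ≤⟨ ℕtoℚ*recip-mono-≤ (s ℕ.* (T ℕ.* (T ℕ.* B))) Q (2 ℕ.* q ℕ.* (s ℕ.* s)) 1
                              (cost-numerator-≤ s q T B s′ T≤2sq) ⟩
      ℕtoℚ (2 ℕ.* q ℕ.* (s ℕ.* s)) * recip 1         ≡⟨ ℚ.*-identityʳ _ ⟩
      ℕtoℚ (2 ℕ.* q ℕ.* (s ℕ.* s))                   ≡⟨ ℕtoℚ-* (2 ℕ.* q) (s ℕ.* s) ⟩
      ℕtoℚ (2 ℕ.* q) * ℕtoℚ (s ℕ.* s)                ≡⟨ cong (ℕtoℚ (2 ℕ.* q) *_) (ℕtoℚ-* s s) ⟩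
      ℕtoℚ (2 ℕ.* q) * (ℕtoℚ s * ℕtoℚ s)             ∎
      where
      open ℚ.≤-Reasoning
      |weights| = length-weights (length-paddedRects |H|≤1+k t)

lemma6p5 : ∀ (ε : ℚ) → 0ℚ < ε → ε < 1ℚ →
    ∃ λ (K : ℚ) → ∀ (n m s : ℕ) (F : Fin m → Clause n) (H : Fin s → Clause n) →
      IsHittingRefutation F H →
      ∀ (a b : ℕ) (e : Fin n ↔ (Fin a ⊎ Fin b)) →
      ∃ λ (L : Weights m a b) → Feasible ε F e L × total L ≤ K * (ℕtoℚ s * ℕtoℚ s)
lemma6p5 ε 0<ε _ = ℕtoℚ (2 ℕ.* ↧ₙ ε) , λ where
  n m zero     F H ref a b e → ⊥-elim (¬Fin0 (proj₁ (proj₁ (proj₂ ref) (λ _ → false))))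
  n m (suc s′) F H ref a b e → partitionBound ref e (↧ₙ ε) (recip[↧ₙ]≤ ε 0<ε)
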